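{- For all integers $h\geq 0$ and $d\geq 1$, the tree $\mathcal{T}^h$ with size parameter $d$ has height $\ell(h)=3((d+1)^h-1)$ and number of nodes $n(h)\leq \frac{3}{2}(h+1)(d+1)^{h+1}$.
   Context: The undirected unweighted rooted tree $\mathcal{T}^h$ with size parameter $d$ is defined recursively. $\mathcal{T}^0$ is a single node, its root. For $h\geq 1$, take $d$ disjoint copies $\mathcal{T}^{h-1}_0,\ldots,\mathcal{T}^{h-1}_{d-1}$ of $\mathcal{T}^{h-1}$, add a new path $v_0,v_1,\ldots,v_{d-1}$, set the root of $\mathcal{T}^h$ to be $v_0$, and for each $j\in\{0,\ldots,d-1\}$ connect $v_j$ to the root of $\mathcal{T}^{h-1}_j$ by a path, with new internal nodes, of length $(d-j)(\ell(h-1)+3)$. Here $\ell(h)$ is the height of $\mathcal{T}^h$ (the maximum distance from its root to any of its nodes) and $n(h)$ its number of nodes. -}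

module Defs where

open import Data.Nat using (ℕ; zero; suc; _+_; _*_; _∸_; _⊔_)
open import Data.List using (List; []; _∷_)

-- Finite rooted trees (rose trees). A rooted undirected tree is represented by its
-- root together with the list of subtrees hanging from the root's children.
data Tree : Set where
  node : List Tree → Tree

mutual
  height : Tree → ℕ
  height (node ts) = heightList ts

  heightList : List Tree → ℕ
  heightList [] = 0
  heightList (t ∷ ts) = suc (height t) ⊔ heightList ts

mutual
  size : Tree → ℕ
  size (node ts) = suc (sizeList ts)

  sizeList : List Tree → ℕ
  sizeList [] = 0
  sizeList (t ∷ ts) = size t + sizeList ts

chain : ℕ → Tree → Tree
chain zero t = t
chain (suc k) t = node (chain k t ∷ [])

-- A new node v joined to the root of t by a path of length L ≥ 1 whose
-- L - 1 internal nodes are new: v's child is the top of chain (L ∸ 1) t.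
pathTo : ℕ → Tree → List Tree → Tree
pathTo L t rest = node (chain (L ∸ 1) t ∷ rest)

-- spine d sub ℓ m builds the node v_j with j = d - m of the path v_0 … v_{d-1}
-- (for 1 ≤ m ≤ d), together with everything below it: v_j is joined to a copy
-- of sub by a path of length (d - j)(ℓ + 3) = m(ℓ + 3), and to v_{j+1} by an edge.
spine : Tree → ℕ → ℕ → Tree
spine sub ℓ zero = node []
spine sub ℓ (suc zero) = pathTo (1 * (ℓ + 3)) sub []
spine sub ℓ (suc (suc m)) = pathTo (suc (suc m) * (ℓ + 3)) sub (spine sub ℓ (suc m) ∷ [])

-- T d h : the tree 𝒯^h with size parameter d (meaningful for d ≥ 1).
T : ℕ → ℕ → Tree
T d zero = node []
T d (suc h) = spine (T d h) (height (T d h)) d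

module Submission where

open import Defs
open import Data.Nat using (ℕ; suc; _+_; _*_; _∸_; _^_; _≤_)
open import Data.Product using (_×_)
open import Relation.Binary.PropositionalEquality using (_≡_)

open import Data.Nat using (zero; _⊔_; s≤s; z≤n)
open import Data.Nat.Properties
open import Data.Nat.Tactic.RingSolver using (solve-∀)
open import Data.Product using (_,_)
open import Data.List using ([]; _∷_)
open import Relation.Binary.PropositionalEquality
  using (refl; cong; sym; trans; subst; module ≡-Reasoning)

-- Writing ℓ(h) + 3 = 3(d+1)^h, the height satisfies ℓ(h+1) + 3 = (d+1)(ℓ(h) + 3),
-- since the deepest node of 𝒯^{h+1} lies below v_0, at distance d(ℓ(h)+3) + ℓ(h).
-- Counting nodes, the d connecting paths have total length (ℓ(h)+3)·d(d+1)/2, so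
-- 2n(h+1) = 3(d+1)^h·d(d+1) + d·2n(h), and the bound follows by induction on h.

height-chain : ∀ k t → height (chain k t) ≡ k + height t
height-chain zero    t = refl
height-chain (suc k) t = trans (⊔-identityʳ _) (cong suc (height-chain k t))

size-chain : ∀ k t → size (chain k t) ≡ k + size t
size-chain zero    t = refl
size-chain (suc k) t = cong suc (trans (+-identityʳ _) (size-chain k t))

suc-∸1 : ∀ {L} → 1 ≤ L → suc (L ∸ 1) ≡ L
suc-∸1 {suc L} _ = refl

height-pathTo : ∀ {L} t rest → 1 ≤ L →
                height (pathTo L t rest) ≡ (L + height t) ⊔ heightList rest
height-pathTo {L} t rest 1≤L = cong (_⊔ heightList rest) (begin
  suc (height (chain (L ∸ 1) t)) ≡⟨ cong suc (height-chain (L ∸ 1) t) ⟩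
  suc (L ∸ 1 + height t)         ≡⟨ cong (_+ height t) (suc-∸1 1≤L) ⟩
  L + height t                   ∎)
  where open ≡-Reasoning

size-pathTo : ∀ {L} t rest → 1 ≤ L →
              size (pathTo L t rest) ≡ L + size t + sizeList rest
size-pathTo {L} t rest 1≤L = begin
  suc (size (chain (L ∸ 1) t) + sizeList rest)
    ≡⟨ cong (λ n → suc (n + sizeList rest)) (size-chain (L ∸ 1) t) ⟩
  suc (L ∸ 1) + size t + sizeList rest
    ≡⟨ cong (λ n → n + size t + sizeList rest) (suc-∸1 1≤L) ⟩
  L + size t + sizeList rest ∎
  where open ≡-Reasoning

1≤ℓ+3 : ∀ ℓ → 1 ≤ ℓ + 3
1≤ℓ+3 ℓ = ≤-trans (s≤s z≤n) (m≤n+m 3 ℓ)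

1≤path-length : ∀ k ℓ → 1 ≤ suc k * (ℓ + 3)
1≤path-length k ℓ = ≤-trans (1≤ℓ+3 ℓ) (m≤m+n (ℓ + 3) (k * (ℓ + 3)))

height-spine : ∀ sub ℓ k → height (spine sub ℓ (suc k)) ≡ suc k * (ℓ + 3) + height sub
height-spine sub ℓ zero =
  trans (height-pathTo sub [] (1≤path-length 0 ℓ)) (⊔-identityʳ _)
height-spine sub ℓ (suc k) = begin
  height (spine sub ℓ (suc (suc k)))
    ≡⟨ height-pathTo sub (spine sub ℓ (suc k) ∷ []) (1≤path-length (suc k) ℓ) ⟩
  (X + height sub) ⊔ (suc (height (spine sub ℓ (suc k))) ⊔ 0)
    ≡⟨ cong ((X + height sub) ⊔_) (trans (⊔-identityʳ _) (cong suc (height-spine sub ℓ k))) ⟩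
  (X + height sub) ⊔ suc (suc k * (ℓ + 3) + height sub)
    ≡⟨ m≥n⇒m⊔n≡m direct-path-longer ⟩
  X + height sub ∎
  where
    open ≡-Reasoning
    X = suc (suc k) * (ℓ + 3)
    direct-path-longer : suc (suc k * (ℓ + 3) + height sub) ≤ X + height sub
    direct-path-longer = ≤-trans (+-monoˡ-≤ (suc k * (ℓ + 3) + height sub) (1≤ℓ+3 ℓ))
                                 (≤-reflexive (sym (+-assoc (ℓ + 3) _ _)))

size-spine : ∀ sub ℓ k →
  2 * size (spine sub ℓ (suc k)) ≡ (ℓ + 3) * suc k * suc (suc k) + 2 * suc k * size sub
size-spine sub ℓ zero = begin
  2 * size (spine sub ℓ 1)             ≡⟨ cong (2 *_) (size-pathTo sub [] (1≤path-length 0 ℓ)) ⟩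
  2 * (1 * (ℓ + 3) + size sub + 0)     ≡⟨ base (ℓ + 3) (size sub) ⟩
  (ℓ + 3) * 1 * 2 + 2 * 1 * size sub   ∎
  where
    open ≡-Reasoning
    base : ∀ c s → 2 * (1 * c + s + 0) ≡ c * 1 * 2 + 2 * 1 * s
    base = solve-∀
size-spine sub ℓ (suc k) = begin
  2 * size (spine sub ℓ (suc (suc k)))
    ≡⟨ cong (2 *_) (size-pathTo sub (spine sub ℓ (suc k) ∷ []) (1≤path-length (suc k) ℓ)) ⟩
  2 * (X + size sub + (size (spine sub ℓ (suc k)) + 0))
    ≡⟨ split (ℓ + 3) k (size sub) _ ⟩
  2 * (X + size sub) + 2 * size (spine sub ℓ (suc k))
    ≡⟨ cong (2 * (X + size sub) +_) (size-spine sub ℓ k) ⟩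
  2 * (X + size sub) + ((ℓ + 3) * suc k * suc (suc k) + 2 * suc k * size sub)
    ≡⟨ gauss (ℓ + 3) k (size sub) ⟩
  (ℓ + 3) * suc (suc k) * suc (suc (suc k)) + 2 * suc (suc k) * size sub ∎
  where
    open ≡-Reasoning
    X = suc (suc k) * (ℓ + 3)
    split : ∀ c k s r → 2 * (suc (suc k) * c + s + (r + 0)) ≡ 2 * (suc (suc k) * c + s) + 2 * r
    split = solve-∀
    gauss : ∀ c k s → 2 * (suc (suc k) * c + s) + (c * suc k * suc (suc k) + 2 * suc k * s)
                      ≡ c * suc (suc k) * suc (suc (suc k)) + 2 * suc (suc k) * s
    gauss = solve-∀

height+3-T : ∀ d h → height (T (suc d) h) + 3 ≡ 3 * (suc d + 1) ^ h
height+3-T d zero    = refl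
height+3-T d (suc h) = begin
  height (spine sub ℓ (suc d)) + 3 ≡⟨ cong (_+ 3) (height-spine sub ℓ d) ⟩
  suc d * (ℓ + 3) + ℓ + 3          ≡⟨ regroup (suc d) ℓ ⟩
  (suc d + 1) * (ℓ + 3)            ≡⟨ cong ((suc d + 1) *_) (height+3-T d h) ⟩
  (suc d + 1) * (3 * P)            ≡⟨ regroup′ (suc d + 1) P ⟩
  3 * (suc d + 1) ^ suc h          ∎
  where
    open ≡-Reasoning
    sub = T (suc d) h
    ℓ = height sub
    P = (suc d + 1) ^ h
    regroup : ∀ D ℓ → D * (ℓ + 3) + ℓ + 3 ≡ (D + 1) * (ℓ + 3)
    regroup = solve-∀
    regroup′ : ∀ b P → b * (3 * P) ≡ 3 * (b * P)
    regroup′ = solve-∀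

2*size-T≤ : ∀ d h → 2 * size (T (suc d) h) ≤ 3 * (h + 1) * (suc d + 1) ^ suc h
2*size-T≤ d zero = ≤-trans (s≤s (s≤s z≤n)) (*-monoʳ-≤ 3 (s≤s z≤n))
2*size-T≤ d (suc h) = begin
  2 * size (spine sub ℓ D)
    ≡⟨ size-spine sub ℓ d ⟩
  (ℓ + 3) * D * suc D + 2 * D * s
    ≡⟨ cong (λ n → n * D * suc D + 2 * D * s) (height+3-T d h) ⟩
  3 * P * D * suc D + 2 * D * s
    ≡⟨ factor-D P D s ⟩
  3 * P * D * (D + 1) + D * (2 * s)
    ≤⟨ +-monoʳ-≤ (3 * P * D * (D + 1)) (*-monoʳ-≤ D (2*size-T≤ d h)) ⟩
  3 * P * D * (D + 1) + D * (3 * (h + 1) * ((D + 1) * P))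
    ≡⟨ collect P D h ⟩
  D * (3 * (suc h + 1) * ((D + 1) * P))
    ≤⟨ *-monoˡ-≤ _ (m≤m+n D 1) ⟩
  (D + 1) * (3 * (suc h + 1) * ((D + 1) * P))
    ≡⟨ reassoc P D h ⟩
  3 * (suc h + 1) * (D + 1) ^ suc (suc h) ∎
  where
    open ≤-Reasoning
    D = suc d
    sub = T D h
    ℓ = height sub
    s = size sub
    P = (D + 1) ^ h
    factor-D : ∀ P D s → 3 * P * D * suc D + 2 * D * s ≡ 3 * P * D * (D + 1) + D * (2 * s)
    factor-D = solve-∀
    collect : ∀ P D h → 3 * P * D * (D + 1) + D * (3 * (h + 1) * ((D + 1) * P))
                        ≡ D * (3 * (suc h + 1) * ((D + 1) * P))
    collect = solve-∀
    reassoc : ∀ P D h → (D + 1) * (3 * (suc h + 1) * ((D + 1) * P))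
                        ≡ 3 * (suc h + 1) * ((D + 1) * ((D + 1) * P))
    reassoc = solve-∀

lemma10 : (h d : ℕ) → 1 ≤ d →
    (height (T d h) ≡ 3 * ((d + 1) ^ h ∸ 1))
      × (2 * size (T d h) ≤ 3 * (h + 1) * (d + 1) ^ (h + 1))
lemma10 h (suc d) _ = height-T , size-T
  where
    open ≡-Reasoning
    height-T : height (T (suc d) h) ≡ 3 * ((suc d + 1) ^ h ∸ 1)
    height-T = begin
      height (T (suc d) h)             ≡⟨ m+n∸n≡m (height (T (suc d) h)) 3 ⟨
      height (T (suc d) h) + 3 ∸ 3     ≡⟨ cong (_∸ 3) (height+3-T d h) ⟩
      3 * (suc d + 1) ^ h ∸ 3 * 1      ≡⟨ *-distribˡ-∸ 3 ((suc d + 1) ^ h) 1 ⟨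
      3 * ((suc d + 1) ^ h ∸ 1)        ∎
    size-T : 2 * size (T (suc d) h) ≤ 3 * (h + 1) * (suc d + 1) ^ (h + 1)
    size-T = subst (λ e → 2 * size (T (suc d) h) ≤ 3 * (h + 1) * (suc d + 1) ^ e)
                   (+-comm 1 h) (2*size-T≤ d h)
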